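{- For the Petersen graph $P$, $d_{\rm st}(P)=2$.
   Context: The Petersen graph is the cubic graph on $\{1,\dots,10\}$ with outer $5$-cycle $1\text{ - }2\text{ - }3\text{ - }4\text{ - }5\text{ - }1$, spokes $1\text{ - }6$, $2\text{ - }7$, $3\text{ - }8$, $4\text{ - }9$, $5\text{ - }10$, and inner pentagram $6\text{ - }8\text{ - }10\text{ - }7\text{ - }9\text{ - }6$. For a finite simple graph $G=(V,E)$, a set $D\subseteq V$ is a strong dominating set if for every vertex $x\in V\setminus D$ there is a vertex $y\in D$ with $xy\in E$ and $\deg(x)\le \deg(y)$. A strong domatic partition of $G$ is a partition of $V(G)$ all of whose classes are strong dominating sets of $G$. The strong domatic number $d_{\rm st}(G)$ is the maximum number of classes of a strong domatic partition of $G$. -}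

module Defs where

open import Data.Nat using (ℕ; zero; suc; _≤_; _<_)
open import Data.Fin using (Fin; zero; suc)
open import Data.Fin.Subset using (Subset; _∈_; _∉_)
open import Data.Bool using (Bool; true; false; T; _∨_)
open import Data.Bool.Properties using (∨-comm)
open import Data.Fin using (toℕ)
open import Relation.Binary.PropositionalEquality using (refl)
open import Data.Vec using (Vec; tabulate; count)
open import Data.Product using (Σ; ∃; _×_; _,_)
open import Relation.Nullary using (¬_)
open import Relation.Nullary.Decidable using (⌊_⌋)
open import Data.Fin using () renaming (_≟_ to _Fin≟_)
open import Data.Bool using () renaming (_≟_ to _Bool≟_)
open import Relation.Binary.PropositionalEquality using (_≡_)

record Graph (n : ℕ) : Set where
  field
    adj      : Fin n → Fin n → Bool
    sym      : ∀ x y → adj x y ≡ adj y x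
    loopless : ∀ x → adj x x ≡ false

open Graph public

Adj : ∀ {n} → Graph n → Fin n → Fin n → Set
Adj G x y = T (adj G x y)

deg : ∀ {n} → Graph n → Fin n → ℕ
deg {n} G x = count (λ y → adj G x y Bool≟ true) (tabulate {n = n} (λ y → y))

IsStrongDominating : ∀ {n} → Graph n → Subset n → Set
IsStrongDominating {n} G D =
  (x : Fin n) → x ∉ D → Σ (Fin n) λ y → (y ∈ D) × Adj G x y × (deg G x ≤ deg G y)

classOf : ∀ {n k} → (Fin n → Fin k) → Fin k → Subset n
classOf f i = tabulate λ x → ⌊ f x Fin≟ i ⌋

-- A strong domatic partition of G into k classes: a map f : Fin n → Fin k
-- (x lies in class f x) such that every class is nonempty (so the k
-- classes really form a partition with k classes) and every class is a
-- strong dominating set of G.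
record StrongDomaticPartition {n : ℕ} (G : Graph n) (k : ℕ) : Set where
  field
    label     : Fin n → Fin k
    nonempty  : (i : Fin k) → Σ (Fin n) λ x → label x ≡ i
    dominates : (i : Fin k) → IsStrongDominating G (classOf label i)

StrongDomaticNumberIs : ∀ {n} → Graph n → ℕ → Set
StrongDomaticNumberIs G m =
  StrongDomaticPartition G m × ((k : ℕ) → StrongDomaticPartition G k → k ≤ m)

-- The Petersen graph on {1,…,10}, with vertex i represented by Fin 10 element i-1.
-- Edge list: outer cycle 1-2-3-4-5-1, spokes i-(i+5), pentagram 6-8-10-7-9-6.
petersenAdjℕ : ℕ → ℕ → Bool
petersenAdjℕ 1 2 = true
petersenAdjℕ 2 3 = true
petersenAdjℕ 3 4 = true
petersenAdjℕ 4 5 = true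
petersenAdjℕ 5 1 = true
petersenAdjℕ 1 6 = true
petersenAdjℕ 2 7 = true
petersenAdjℕ 3 8 = true
petersenAdjℕ 4 9 = true
petersenAdjℕ 5 10 = true
petersenAdjℕ 6 8 = true
petersenAdjℕ 8 10 = true
petersenAdjℕ 10 7 = true
petersenAdjℕ 7 9 = true
petersenAdjℕ 9 6 = true
petersenAdjℕ _ _ = false

petersenAdj : Fin 10 → Fin 10 → Bool
petersenAdj x y = petersenAdjℕ (suc (toℕ x)) (suc (toℕ y)) ∨ petersenAdjℕ (suc (toℕ y)) (suc (toℕ x))

petersenLoopless : ∀ x → petersenAdj x x ≡ false
petersenLoopless zero = refl
petersenLoopless (suc zero) = refl
petersenLoopless (suc (suc zero)) = refl
petersenLoopless (suc (suc (suc zero))) = refl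
petersenLoopless (suc (suc (suc (suc zero)))) = refl
petersenLoopless (suc (suc (suc (suc (suc zero))))) = refl
petersenLoopless (suc (suc (suc (suc (suc (suc zero)))))) = refl
petersenLoopless (suc (suc (suc (suc (suc (suc (suc zero))))))) = refl
petersenLoopless (suc (suc (suc (suc (suc (suc (suc (suc zero)))))))) = refl
petersenLoopless (suc (suc (suc (suc (suc (suc (suc (suc (suc zero))))))))) = refl

Petersen : Graph 10
Petersen = record
  { adj = petersenAdj
  ; sym = λ x y → ∨-comm (petersenAdjℕ (suc (toℕ x)) (suc (toℕ y))) (petersenAdjℕ (suc (toℕ y)) (suc (toℕ x)))
  ; loopless = petersenLoopless
  }

{-# OPTIONS --safe #-}
module Submission where

open import Defs
open import Data.Nat using (ℕ; zero; suc; _≤_; z≤n; s≤s; _≤?_)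
import Data.Nat as ℕ
open import Data.Nat.Properties using (≤-reflexive; ≰⇒>)
open import Data.Fin using (Fin; zero; suc; splitAt; _≟_)
open import Data.Fin.Patterns
open import Data.Fin.Properties using (any?; all?)
open import Data.Fin.Permutation.Components using (transpose; transpose-inverse)
open import Data.Fin.Subset using (_∈_)
open import Data.Bool.Properties using (T-≡)
open import Data.Empty using (⊥-elim)
open import Data.Bool using (Bool; T)
open import Data.Bool.ListAction using (all; any)
open import Data.List using (List; []; _∷_; allFin)
open import Data.List.Relation.Unary.All.Properties using (all⁺; all⁻; tabulate⁺; tabulate⁻)
open import Data.List.Relation.Unary.Any.Properties using (any⁺; any⁻)
open import Data.List.Membership.Propositional using (lose) renaming (_∈_ to _∈ₗ_)
open import Data.List.Relation.Unary.Any as Any using (Any)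
open import Data.Product using (∃; _×_; _,_)
open import Data.Sum using (_⊎_; inj₁; inj₂; [_,_])
open import Data.Vec using (lookup)
open import Data.Vec.Properties using (lookup⇒[]=; []=⇒lookup; lookup∘tabulate)
open import Data.Vec.Functional using () renaming (_∷_ to _◂_)
open import Function using (_∘_; const; Equivalence)
open import Relation.Nullary using (Dec; yes; no; ¬_)
open import Relation.Nullary.Decidable
  using (⌊_⌋; toWitness; fromWitness; dec-true; map′; _×-dec_; _⊎-dec_; _→-dec_; T?)
open import Relation.Nullary.Decidable using (from-yes; from-no)
open import Relation.Binary.PropositionalEquality using (_≡_; refl; trans; cong; _≗_)
import Relation.Binary.PropositionalEquality as ≡

-- Call a colouring domatic when every closed neighbourhood sees every colour,
-- i.e. every colour class dominates.  In a regular graph the degree condition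
-- of strong domination is automatic, so the strong domatic partitions of the
-- cubic Petersen graph are its surjective domatic colourings.  The outer and
-- inner 5-cycles, matched by the spokes, form a domatic 2-colouring.  Merging
-- classes turns a strong domatic partition with three or more classes into a
-- domatic 3-colouring, which after permuting colours gives vertex 1 colour 0;
-- an exhaustive search over the remaining 3⁹ colourings finds none.

module _ {n k : ℕ} {f : Fin n → Fin k} {i : Fin k} {x : Fin n} where

  private
    lookup-classOf : lookup (classOf f i) x ≡ ⌊ f x ≟ i ⌋
    lookup-classOf = lookup∘tabulate (λ z → ⌊ f z ≟ i ⌋) x

  ∈-classOf⁺ : f x ≡ i → x ∈ classOf f i
  ∈-classOf⁺ fx≡i =
    lookup⇒[]= x _ (trans lookup-classOf (Equivalence.to T-≡ (fromWitness fx≡i)))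

  ∈-classOf⁻ : x ∈ classOf f i → f x ≡ i
  ∈-classOf⁻ x∈ =
    toWitness (Equivalence.from T-≡ (trans (≡.sym lookup-classOf) ([]=⇒lookup x∈)))

ClosedAdj : ∀ {n} → Graph n → Fin n → Fin n → Set
ClosedAdj G x y = x ≡ y ⊎ Adj G x y

open StrongDomaticPartition using (label; dominates)

IsDomaticColouring : ∀ {n k} → Graph n → (Fin n → Fin k) → Set
IsDomaticColouring {n} {k} G f =
  (x : Fin n) (c : Fin k) → ∃ λ y → ClosedAdj G x y × f y ≡ c

module _ {n k : ℕ} (G : Graph n) where

  isDomaticColouring? : (f : Fin n → Fin k) → Dec (IsDomaticColouring G f)
  isDomaticColouring? f = all? λ x → all? λ c → any? λ y →
    ((x ≟ y) ⊎-dec T? (adj G x y)) ×-dec (f y ≟ c)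

  isDomaticColouring-∘ : ∀ {m} {f : Fin n → Fin k} {g : Fin k → Fin m} →
                         (∀ j → ∃ λ i → g i ≡ j) →
                         IsDomaticColouring G f → IsDomaticColouring G (g ∘ f)
  isDomaticColouring-∘ {g = g} g-onto dom x c with g-onto c
  ... | i , gi≡c with dom x i
  ...   | y , xy , fy≡i = y , xy , trans (cong g fy≡i) gi≡c

  isDomaticColouring-recolour : ∀ {f : Fin n → Fin k} → IsDomaticColouring G f →
                                ∀ v c → ∃ λ g → IsDomaticColouring G g × g v ≡ c
  isDomaticColouring-recolour {f} dom v c =
    transpose (f v) c ∘ f ,
    isDomaticColouring-∘ {g = transpose (f v) c}
      (λ j → transpose c (f v) j , transpose-inverse (f v) c) dom ,
    transpose-matches (f v) c
    where
    transpose-matches : ∀ i j → transpose i j i ≡ j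
    transpose-matches i j rewrite dec-true (i ≟ i) refl = refl

  strongDomaticPartition⇒isDomaticColouring :
    (p : StrongDomaticPartition G k) → IsDomaticColouring G (label p)
  strongDomaticPartition⇒isDomaticColouring p x c with label p x ≟ c
  ... | yes x∈c = x , inj₁ refl , x∈c
  ... | no x∉c with dominates p c x (x∉c ∘ ∈-classOf⁻)
  ...   | y , y∈c , xy , _ = y , inj₂ xy , ∈-classOf⁻ y∈c

isDomaticColouring⇒strongDomaticPartition :
  ∀ {n k r} (G : Graph (suc n)) → (∀ x → deg G x ≡ r) →
  (f : Fin (suc n) → Fin k) → IsDomaticColouring G f → StrongDomaticPartition G k
isDomaticColouring⇒strongDomaticPartition G regular f dom = record
  { label     = f
  ; nonempty  = λ c → let y , _ , fy≡c = dom zero c in y , fy≡c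
  ; dominates = classes-dominate
  }
  where
  classes-dominate : ∀ c → IsStrongDominating G (classOf f c)
  classes-dominate c x x∉c with dom x c
  ... | _ , inj₁ refl , fx≡c = ⊥-elim (x∉c (∈-classOf⁺ {f = f} fx≡c))
  ... | y , inj₂ xy   , fy≡c =
    y , ∈-classOf⁺ {f = f} fy≡c , xy , ≤-reflexive (trans (regular x) (≡.sym (regular y)))

SeesEveryColour : ∀ {n k} → (Fin n → List (Fin n)) → (Fin n → Fin k) → Set
SeesEveryColour {n} {k} N f = (x : Fin n) (c : Fin k) → Any (λ y → f y ≡ c) (N x)

module _ {n k : ℕ} (N : Fin n → List (Fin n)) where

  seesEveryColourᵇ : (Fin n → Fin k) → Bool
  seesEveryColourᵇ f =
    all (λ x → all (λ c → any (λ y → ⌊ f y ≟ c ⌋) (N x)) (allFin k)) (allFin n)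

  -- Normalising this Boolean check is several times faster than a nest of Dec combinators.
  seesEveryColour? : (f : Fin n → Fin k) → Dec (SeesEveryColour N f)
  seesEveryColour? f = map′ sound complete (T? (seesEveryColourᵇ f))
    where
    sound : T (seesEveryColourᵇ f) → SeesEveryColour N f
    sound t x c = Any.map toWitness
      (any⁻ _ _ (tabulate⁻ (all⁺ _ _ (tabulate⁻ (all⁺ _ _ t) x)) c))

    complete : SeesEveryColour N f → T (seesEveryColourᵇ f)
    complete sees = all⁻ _ (tabulate⁺ λ x → all⁻ _ (tabulate⁺ λ c →
      any⁺ _ (Any.map fromWitness (sees x c))))

  seesEveryColour-resp-≗ : ∀ {f g : Fin n → Fin k} → f ≗ g →
                           SeesEveryColour N f → SeesEveryColour N g
  seesEveryColour-resp-≗ f≗g sees x c =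
    Any.map (λ {y} → trans (≡.sym (f≗g y))) (sees x c)

  isDomaticColouring⇒seesEveryColour :
    (G : Graph n) → (∀ {x y} → ClosedAdj G x y → y ∈ₗ N x) →
    ∀ {f : Fin n → Fin k} → IsDomaticColouring G f → SeesEveryColour N f
  isDomaticColouring⇒seesEveryColour G N-complete dom x c with dom x c
  ... | y , xy , fy≡c = lose (N-complete xy) fy≡c

anyFunction? : ∀ n {k} {P : (Fin n → Fin k) → Set} →
               (∀ {f g} → f ≗ g → P f → P g) → (∀ f → Dec (P f)) → Dec (∃ P)
anyFunction? zero resp P? with P? (λ ())
... | yes p = yes (_ , p)
... | no ¬p = no λ (_ , p) → ¬p (resp (λ ()) p)
anyFunction? (suc n) {P = P} resp P? =
  map′ (λ (c , g , p) → c ◂ g , p) split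
       (any? λ c → anyFunction? n (resp ∘ ◂-resp c) (P? ∘ (c ◂_)))
  where
  ◂-resp : ∀ {k} (c : Fin k) {g h : Fin n → Fin k} → g ≗ h → c ◂ g ≗ c ◂ h
  ◂-resp c g≗h zero    = refl
  ◂-resp c g≗h (suc i) = g≗h i

  split : ∃ P → ∃ λ c → ∃ λ g → P (c ◂ g)
  split (f , p) = f zero , f ∘ suc , resp (λ { zero → refl ; (suc i) → refl }) p

squash : ∀ {m n} → m ≤ n → Fin (suc n) → Fin (suc m)
squash _       zero    = zero
squash z≤n     (suc i) = zero
squash (s≤s p) (suc i) = suc (squash p i)

squash-onto : ∀ {m n} (p : m ≤ n) j → ∃ λ i → squash p i ≡ j
squash-onto p       zero    = zero , refl
squash-onto (s≤s p) (suc j) with squash-onto p j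
... | i , squash-i≡j = suc i , cong suc squash-i≡j

petersen-cubic : ∀ x → deg Petersen x ≡ 3
petersen-cubic = from-yes (all? λ x → deg Petersen x ℕ.≟ 3)

outerInner : Fin 10 → Fin 2
outerInner = [ const 0F , const 1F ] ∘ splitAt 5

outerInner-domatic : IsDomaticColouring Petersen outerInner
outerInner-domatic = from-yes (isDomaticColouring? Petersen outerInner)

petersenClosedNbhd : Fin 10 → List (Fin 10)
petersenClosedNbhd 0F = 0F ∷ 1F ∷ 4F ∷ 5F ∷ []
petersenClosedNbhd 1F = 1F ∷ 0F ∷ 2F ∷ 6F ∷ []
petersenClosedNbhd 2F = 2F ∷ 1F ∷ 3F ∷ 7F ∷ []
petersenClosedNbhd 3F = 3F ∷ 2F ∷ 4F ∷ 8F ∷ []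
petersenClosedNbhd 4F = 4F ∷ 3F ∷ 0F ∷ 9F ∷ []
petersenClosedNbhd 5F = 5F ∷ 0F ∷ 7F ∷ 8F ∷ []
petersenClosedNbhd 6F = 6F ∷ 1F ∷ 8F ∷ 9F ∷ []
petersenClosedNbhd 7F = 7F ∷ 2F ∷ 9F ∷ 5F ∷ []
petersenClosedNbhd 8F = 8F ∷ 3F ∷ 5F ∷ 6F ∷ []
petersenClosedNbhd 9F = 9F ∷ 4F ∷ 6F ∷ 7F ∷ []

petersenClosedNbhd-complete : ∀ {x y} → ClosedAdj Petersen x y → y ∈ₗ petersenClosedNbhd x
petersenClosedNbhd-complete {x} {y} = from-yes (all? λ u → all? λ v →
  (u ≟ v ⊎-dec T? (adj Petersen u v)) →-dec Any.any? (v ≟_) (petersenClosedNbhd u)) x y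

petersen-no-normalised-3-colouring :
  ¬ ∃ λ (h : Fin 9 → Fin 3) → SeesEveryColour petersenClosedNbhd (0F ◂ h)
petersen-no-normalised-3-colouring = from-no
  (anyFunction? 9 {k = 3}
    (λ g≗h → seesEveryColour-resp-≗ petersenClosedNbhd
               λ { 0F → refl ; (suc i) → g≗h i })
    (λ h → seesEveryColour? petersenClosedNbhd (0F ◂ h)))

petersen-no-domatic-3-colouring : ∀ {f : Fin 10 → Fin 3} → ¬ IsDomaticColouring Petersen f
petersen-no-domatic-3-colouring dom
  with isDomaticColouring-recolour Petersen dom 0F 0F
... | g , g-dom , g0≡0 = petersen-no-normalised-3-colouring
  (g ∘ suc , seesEveryColour-resp-≗ petersenClosedNbhd
               (λ { 0F → g0≡0 ; (suc i) → refl })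
               (isDomaticColouring⇒seesEveryColour petersenClosedNbhd Petersen
                  petersenClosedNbhd-complete g-dom))

theorem3p3 : StrongDomaticNumberIs Petersen 2
theorem3p3 =
  isDomaticColouring⇒strongDomaticPartition Petersen petersen-cubic
    outerInner outerInner-domatic ,
  atMostTwo
  where
  atMostTwo : (k : ℕ) → StrongDomaticPartition Petersen k → k ≤ 2
  atMostTwo k p with k ≤? 2
  ... | yes k≤2 = k≤2
  ... | no k≰2 with ≰⇒> k≰2
  ...   | s≤s 2≤k′ = ⊥-elim (petersen-no-domatic-3-colouring
            (isDomaticColouring-∘ Petersen (squash-onto 2≤k′)
              (strongDomaticPartition⇒isDomaticColouring Petersen p)))
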